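{- Let $\nu>2$ and let $\sigma\colon V(C_\nu)\to\{0,1\}$ be a configuration. Let $b'(\sigma)$ be the number of side edges $(u,v)$ of $C_\nu$ with $\sigma(u)=\sigma(v)=0$ and $c'(\sigma)$ the number of side edges with $\sigma(u)=\sigma(v)=1$. Then $$\ell(\sigma)=\tfrac14\bigl(c(\sigma)-b(\sigma)\bigr)+\tfrac18\bigl(c'(\sigma)-b'(\sigma)\bigr)+\nu(\nu+1).$$
   Context: The gadget $C_\nu$ has vertex set $\mathbb{Z}/2\nu\mathbb{Z}\times\{0,\dots,\nu\}$; $(x,y)$ and $(x',y')$ are adjacent iff ($y=y'$ and $x=x'\pm1$ mod $2\nu$) or ($x=x'$ and $y=y'\pm1$). $b(\sigma)$ and $c(\sigma)$ are the numbers of edges of $C_\nu$ with both endpoints of spin $0$, resp. spin $1$; $\ell(\sigma)$ is the number of vertices of spin $1$. A side vertex is a vertex $(x,y)$ with $y=0$ or $y=\nu$; a side edge is an edge of $C_\nu$ between two side vertices. -}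

module Defs where

open import Data.Nat using (ℕ; zero; suc; _*_; _+_)
open import Data.Nat.DivMod using (_mod_)
open import Data.Fin using (Fin; toℕ; inject₁) renaming (zero to fzero; suc to fsuc)
open import Data.Fin.Properties using () renaming (_≟_ to _≟ᶠ_)
open import Data.List using (List; []; _∷_; map; concatMap; allFin; filter; length; _++_)
open import Data.Product using (_×_; _,_; proj₁; proj₂)
open import Data.Sum using (_⊎_)
open import Relation.Binary.PropositionalEquality using (_≡_)
open import Relation.Nullary using (Dec)
open import Relation.Nullary.Decidable using (_×-dec_; _⊎-dec_)
import Data.Nat.Properties as ℕP

-- Vertices of the gadget C_ν : (Z/2νZ) × {0,…,ν}
Vertex : ℕ → Set
Vertex ν = Fin (2 * ν) × Fin (suc ν)

Config : ℕ → Set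
Config ν = Vertex ν → Fin 2

next : ∀ n → Fin n → Fin n
next zero ()
next (suc m) x = suc (toℕ x) mod (suc m)

vertices : ∀ ν → List (Vertex ν)
vertices ν = concatMap (λ y → map (λ x → (x , y)) (allFin (2 * ν))) (allFin (suc ν))

Edge : ℕ → Set
Edge ν = Vertex ν × Vertex ν

hEdges : ∀ ν → List (Edge ν)
hEdges ν = concatMap (λ y → map (λ x → ((x , y) , (next (2 * ν) x , y))) (allFin (2 * ν)))
                     (allFin (suc ν))

vEdges : ∀ ν → List (Edge ν)
vEdges ν = concatMap (λ y → map (λ x → ((x , inject₁ y) , (x , fsuc y))) (allFin (2 * ν)))
                     (allFin ν)

-- The edge set of C_ν, each (unordered) edge listed exactly once (for ν > 2)
edges : ∀ ν → List (Edge ν)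
edges ν = hEdges ν ++ vEdges ν

bothSpin : ∀ {ν} → Config ν → Fin 2 → Edge ν → Set
bothSpin σ s (u , v) = σ u ≡ s × σ v ≡ s

bothSpin? : ∀ {ν} (σ : Config ν) (s : Fin 2) (e : Edge ν) → Dec (bothSpin σ s e)
bothSpin? σ s (u , v) = (σ u ≟ᶠ s) ×-dec (σ v ≟ᶠ s)

isSide : ∀ {ν} → Vertex ν → Set
isSide {ν} (x , y) = toℕ y ≡ 0 ⊎ toℕ y ≡ ν

isSide? : ∀ {ν} (v : Vertex ν) → Dec (isSide v)
isSide? {ν} (x , y) = (toℕ y ℕP.≟ 0) ⊎-dec (toℕ y ℕP.≟ ν)

isSideEdge : ∀ {ν} → Edge ν → Set
isSideEdge (u , v) = isSide u × isSide v

isSideEdge? : ∀ {ν} (e : Edge ν) → Dec (isSideEdge e)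
isSideEdge? (u , v) = isSide? u ×-dec isSide? v

sideEdges : ∀ ν → List (Edge ν)
sideEdges ν = filter isSideEdge? (edges ν)

zero₂ one₂ : Fin 2
zero₂ = fzero
one₂ = fsuc fzero

b c : ∀ {ν} → Config ν → ℕ
b {ν} σ = length (filter (bothSpin? σ zero₂) (edges ν))
c {ν} σ = length (filter (bothSpin? σ one₂) (edges ν))

b′ c′ : ∀ {ν} → Config ν → ℕ
b′ {ν} σ = length (filter (bothSpin? σ zero₂) (sideEdges ν))
c′ {ν} σ = length (filter (bothSpin? σ one₂) (sideEdges ν))

ℓ : ∀ {ν} → Config ν → ℕ
ℓ {ν} σ = length (filter (λ v → σ v ≟ᶠ one₂) (vertices ν))

-- Give every edge e of C_ν the weight w(e) = 2 + [e is a side edge].  Every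
-- vertex then has weighted degree 8: an interior vertex lies on four edges of
-- weight 2, a side vertex on two horizontal side edges of weight 3 and on one
-- vertical edge of weight 2 (for ν ≥ 2 no vertical edge is a side edge).
-- Hence, for every f : V(C_ν) → ℕ, the weighted handshake identity
--     Σₑ w(e) (f(u) + f(v)) = 8 Σᵥ f(v)
-- holds; it is proved row by row, using that a row sum is invariant under the
-- rotation x ↦ x + 1 of ℤ/2νℤ.  For spins s, t ∈ {0,1} one has
--     [s = t = 1] + 1 = [s = 1] + [t = 1] + [s = t = 0].
-- Multiplying by w(e) and summing over all edges, the handshake identity for
-- f = [σ = 1] and for f = 1 together with Σₑ w(e)[e has both spins i] =
-- 2·(edges with both spins i) + (side edges with both spins i) yield
--     8ℓ + 2b + b′ = 2c + c′ + 8ν(ν+1)            in ℕ,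
-- and Lemma 8 is this identity divided by 8 in ℚ.
module Submission where

open import Defs

module Counting where

  open import Level using (Level)
  open import Data.Nat using (ℕ; zero; suc; _+_; _*_; s≤s)
  import Data.Nat.Properties as ℕP
  open import Data.Nat.DivMod using (_%_; m<n⇒m%n≡m; n%n≡0)
  open import Data.Nat.Tactic.RingSolver using (solve-∀)
  open import Data.Bool using (true; false; if_then_else_)
  open import Data.Fin using (Fin; toℕ; inject₁; fromℕ) renaming (zero to fzero; suc to fsuc)
  open import Data.Fin.Properties using (toℕ-injective; toℕ-fromℕ<; toℕ-inject₁; toℕ-fromℕ; toℕ<n)
    renaming (_≟_ to _≟ᶠ_)
  open import Data.List using (List; []; _∷_; map; concat; tabulate; allFin; filter; length; _++_)
  open import Data.List.Properties using (map-tabulate)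
  open import Data.Product using (_,_; proj₁; proj₂)
  open import Data.Sum using (_⊎_; inj₁; inj₂)
  open import Function using (_∘_; id)
  open import Relation.Nullary using (Dec; yes; no; does; ¬_)
  open import Relation.Nullary.Decidable using (_×-dec_; _⊎-dec_; dec-true; dec-false)
  open import Relation.Unary using (Pred; Decidable)
  open import Relation.Binary.PropositionalEquality
    using (_≡_; refl; cong; cong₂; trans; sym; module ≡-Reasoning)
  open import Algebra.Properties.Semiring.Sum ℕP.+-*-semiring
    using (sum; sum-cong-≗; ∑-distrib-+; *-distribˡ-sum; sum-init-last)
  open import Algebra.Properties.CommutativeSemigroup ℕP.+-commutativeSemigroup
    using () renaming (interchange to +-interchange)
  open ≡-Reasoning

  𝟙 : ∀ {p} {P : Set p} → Dec P → ℕ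
  𝟙 d = if does d then 1 else 0

  𝟙-yes : ∀ {p} {P : Set p} (d : Dec P) → P → 𝟙 d ≡ 1
  𝟙-yes d p rewrite dec-true d p = refl

  𝟙-no : ∀ {p} {P : Set p} (d : Dec P) → ¬ P → 𝟙 d ≡ 0
  𝟙-no d ¬p rewrite dec-false d ¬p = refl

  𝟙-×-idem : ∀ {p} {P : Set p} (d : Dec P) → 𝟙 (d ×-dec d) ≡ 𝟙 d
  𝟙-×-idem (yes _) = refl
  𝟙-×-idem (no _) = refl

  private
    variable
      a : Level
      A : Set a

  ∑ₗ : (A → ℕ) → List A → ℕ
  ∑ₗ f [] = 0
  ∑ₗ f (x ∷ xs) = f x + ∑ₗ f xs

  ∑ₗ-cong : ∀ {f g : A → ℕ} → (∀ x → f x ≡ g x) → ∀ xs → ∑ₗ f xs ≡ ∑ₗ g xs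
  ∑ₗ-cong f≗g [] = refl
  ∑ₗ-cong f≗g (x ∷ xs) = cong₂ _+_ (f≗g x) (∑ₗ-cong f≗g xs)

  ∑ₗ-++ : ∀ (f : A → ℕ) xs ys → ∑ₗ f (xs ++ ys) ≡ ∑ₗ f xs + ∑ₗ f ys
  ∑ₗ-++ f [] ys = refl
  ∑ₗ-++ f (x ∷ xs) ys = trans (cong (f x +_) (∑ₗ-++ f xs ys)) (sym (ℕP.+-assoc (f x) _ _))

  ∑ₗ-+ : ∀ (f g : A → ℕ) xs → ∑ₗ (λ x → f x + g x) xs ≡ ∑ₗ f xs + ∑ₗ g xs
  ∑ₗ-+ f g [] = refl
  ∑ₗ-+ f g (x ∷ xs) = trans (cong (f x + g x +_) (∑ₗ-+ f g xs))
                            (+-interchange (f x) (g x) (∑ₗ f xs) (∑ₗ g xs))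

  ∑ₗ-* : ∀ k (f : A → ℕ) xs → ∑ₗ (λ x → k * f x) xs ≡ k * ∑ₗ f xs
  ∑ₗ-* k f [] = sym (ℕP.*-zeroʳ k)
  ∑ₗ-* k f (x ∷ xs) = trans (cong (k * f x +_) (∑ₗ-* k f xs)) (sym (ℕP.*-distribˡ-+ k (f x) _))

  ∑ₗ-concat : ∀ (f : A → ℕ) xss → ∑ₗ f (concat xss) ≡ ∑ₗ (∑ₗ f) xss
  ∑ₗ-concat f [] = refl
  ∑ₗ-concat f (xs ∷ xss) = trans (∑ₗ-++ f xs (concat xss)) (cong (∑ₗ f xs +_) (∑ₗ-concat f xss))

  ∑ₗ-tabulate : ∀ {n} (f : A → ℕ) (g : Fin n → A) → ∑ₗ f (tabulate g) ≡ sum (f ∘ g)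
  ∑ₗ-tabulate {n = zero} f g = refl
  ∑ₗ-tabulate {n = suc n} f g = cong (f (g fzero) +_) (∑ₗ-tabulate f (g ∘ fsuc))

  ∑ₗ-map-allFin : ∀ {n} (f : A → ℕ) (g : Fin n → A) → ∑ₗ f (map g (allFin n)) ≡ sum (f ∘ g)
  ∑ₗ-map-allFin f g = trans (cong (∑ₗ f) (map-tabulate id g)) (∑ₗ-tabulate f g)

  ∑ₗ-grid : ∀ k m (f : A → ℕ) (g : Fin k → Fin m → A) →
    ∑ₗ f (concat (map (λ y → map (g y) (allFin m)) (allFin k))) ≡ sum (λ y → sum (λ x → f (g y x)))
  ∑ₗ-grid k m f g = begin
    ∑ₗ f (concat (map (λ y → map (g y) (allFin m)) (allFin k)))
      ≡⟨ ∑ₗ-concat f (map (λ y → map (g y) (allFin m)) (allFin k)) ⟩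
    ∑ₗ (∑ₗ f) (map (λ y → map (g y) (allFin m)) (allFin k))
      ≡⟨ ∑ₗ-map-allFin (∑ₗ f) (λ y → map (g y) (allFin m)) ⟩
    sum (λ y → ∑ₗ f (map (g y) (allFin m)))
      ≡⟨ sum-cong-≗ (λ y → ∑ₗ-map-allFin f (g y)) ⟩
    sum (λ y → sum (λ x → f (g y x))) ∎

  module _ {p} {P : Pred A p} (P? : Decidable P) where

    length-filter : ∀ xs → length (filter P? xs) ≡ ∑ₗ (𝟙 ∘ P?) xs
    length-filter [] = refl
    length-filter (x ∷ xs) with does (P? x)
    ... | true = cong suc (length-filter xs)
    ... | false = length-filter xs

    ∑ₗ-filter : ∀ (f : A → ℕ) xs → ∑ₗ f (filter P? xs) ≡ ∑ₗ (λ x → 𝟙 (P? x) * f x) xs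
    ∑ₗ-filter f [] = refl
    ∑ₗ-filter f (x ∷ xs) with does (P? x)
    ... | true = cong₂ _+_ (sym (ℕP.+-identityʳ (f x))) (∑ₗ-filter f xs)
    ... | false = ∑ₗ-filter f xs

  sum-const : ∀ n k → sum (λ (_ : Fin n) → k) ≡ n * k
  sum-const zero k = refl
  sum-const (suc n) k = cong (k +_) (sum-const n k)

  next-inject₁ : ∀ m (y : Fin m) → next (suc m) (inject₁ y) ≡ fsuc y
  next-inject₁ m y = toℕ-injective (begin
    toℕ (next (suc m) (inject₁ y)) ≡⟨ toℕ-fromℕ< _ ⟩
    suc (toℕ (inject₁ y)) % suc m  ≡⟨ cong (λ z → suc z % suc m) (toℕ-inject₁ y) ⟩
    suc (toℕ y) % suc m            ≡⟨ m<n⇒m%n≡m (s≤s (toℕ<n y)) ⟩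
    suc (toℕ y)                    ∎)

  next-fromℕ : ∀ m → next (suc m) (fromℕ m) ≡ fzero
  next-fromℕ m = toℕ-injective (begin
    toℕ (next (suc m) (fromℕ m)) ≡⟨ toℕ-fromℕ< _ ⟩
    suc (toℕ (fromℕ m)) % suc m  ≡⟨ cong (λ z → suc z % suc m) (toℕ-fromℕ m) ⟩
    suc m % suc m                ≡⟨ n%n≡0 (suc m) ⟩
    0                            ∎)

  sum-rotate : ∀ m (g : Fin (suc m) → ℕ) → sum (g ∘ next (suc m)) ≡ sum g
  sum-rotate m g = begin
    sum (g ∘ next (suc m))
      ≡⟨ sum-init-last (g ∘ next (suc m)) ⟩
    sum (g ∘ next (suc m) ∘ inject₁) + g (next (suc m) (fromℕ m))
      ≡⟨ cong₂ _+_ (sum-cong-≗ (cong g ∘ next-inject₁ m)) (cong g (next-fromℕ m)) ⟩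
    sum (g ∘ fsuc) + g fzero
      ≡⟨ ℕP.+-comm _ (g fzero) ⟩
    sum g ∎

  spin-identity : (s t : Fin 2) →
    𝟙 ((s ≟ᶠ one₂) ×-dec (t ≟ᶠ one₂)) + 1
      ≡ 𝟙 (s ≟ᶠ one₂) + 𝟙 (t ≟ᶠ one₂) + 𝟙 ((s ≟ᶠ zero₂) ×-dec (t ≟ᶠ zero₂))
  spin-identity fzero fzero = refl
  spin-identity fzero (fsuc fzero) = refl
  spin-identity (fsuc fzero) fzero = refl
  spin-identity (fsuc fzero) (fsuc fzero) = refl

  -- The gadget C_ν for ν = k + 2; the argument only needs ν ≥ 2.
  module Gadget (k : ℕ) where

    ν : ℕ
    ν = suc (suc k)

    sideRow : Fin (suc ν) → ℕ
    sideRow y = 𝟙 ((toℕ y ℕP.≟ 0) ⊎-dec (toℕ y ℕP.≟ ν))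

    sideRow-first : sideRow fzero ≡ 1
    sideRow-first = 𝟙-yes ((0 ℕP.≟ 0) ⊎-dec (0 ℕP.≟ ν)) (inj₁ refl)

    sideRow-last : sideRow (fromℕ ν) ≡ 1
    sideRow-last = 𝟙-yes ((toℕ (fromℕ ν) ℕP.≟ 0) ⊎-dec (toℕ (fromℕ ν) ℕP.≟ ν)) (inj₂ (toℕ-fromℕ ν))

    sideRow-interior : ∀ (y : Fin (suc k)) → sideRow (fsuc (inject₁ y)) ≡ 0
    sideRow-interior y = 𝟙-no ((toℕ (fsuc (inject₁ y)) ℕP.≟ 0) ⊎-dec (toℕ (fsuc (inject₁ y)) ℕP.≟ ν)) interior
      where
      interior : ¬ (toℕ (fsuc (inject₁ y)) ≡ 0 ⊎ toℕ (fsuc (inject₁ y)) ≡ ν)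
      interior (inj₁ ())
      interior (inj₂ y+1≡ν) = ℕP.<-irrefl (trans (sym (toℕ-inject₁ y)) (ℕP.suc-injective y+1≡ν)) (toℕ<n y)

    sum-sideRows : ∀ (r : Fin (suc ν) → ℕ) → sum (λ y → sideRow y * r y) ≡ r fzero + r (fromℕ ν)
    sum-sideRows r = begin
      sum (λ y → sideRow y * r y)
        ≡⟨⟩
      sideRow fzero * r fzero + sum (λ y → sideRow (fsuc y) * r (fsuc y))
        ≡⟨ cong (sideRow fzero * r fzero +_) (sum-init-last (λ y → sideRow (fsuc y) * r (fsuc y))) ⟩
      sideRow fzero * r fzero + (sum (λ y → sideRow (fsuc (inject₁ y)) * r (fsuc (inject₁ y)))
                                 + sideRow (fromℕ ν) * r (fromℕ ν))
        ≡⟨ cong₂ (λ s t → s * r fzero + (t + sideRow (fromℕ ν) * r (fromℕ ν))) sideRow-first interior-vanishes ⟩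
      1 * r fzero + (0 + sideRow (fromℕ ν) * r (fromℕ ν))
        ≡⟨ cong (λ s → 1 * r fzero + s * r (fromℕ ν)) sideRow-last ⟩
      1 * r fzero + (0 + 1 * r (fromℕ ν))
        ≡⟨ cong₂ _+_ (ℕP.*-identityˡ (r fzero)) (ℕP.*-identityˡ (r (fromℕ ν))) ⟩
      r fzero + r (fromℕ ν) ∎
      where
      interior-vanishes : sum (λ y → sideRow (fsuc (inject₁ y)) * r (fsuc (inject₁ y))) ≡ 0
      interior-vanishes = begin
        sum (λ y → sideRow (fsuc (inject₁ y)) * r (fsuc (inject₁ y)))
          ≡⟨ sum-cong-≗ (λ y → cong (_* r (fsuc (inject₁ y))) (sideRow-interior y)) ⟩
        sum (λ (_ : Fin (suc k)) → 0) ≡⟨ sum-const (suc k) 0 ⟩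
        suc k * 0                     ≡⟨ ℕP.*-zeroʳ (suc k) ⟩
        0                             ∎

    horizontal-rows : ∀ (r : Fin (suc ν) → ℕ) →
      sum (λ y → (2 + sideRow y) * (r y + r y)) ≡ 4 * sum r + 2 * (r fzero + r (fromℕ ν))
    horizontal-rows r = begin
      sum (λ y → (2 + sideRow y) * (r y + r y))
        ≡⟨ sum-cong-≗ (λ y → expand (sideRow y) (r y)) ⟩
      sum (λ y → 4 * r y + 2 * (sideRow y * r y))
        ≡⟨ ∑-distrib-+ (λ y → 4 * r y) (λ y → 2 * (sideRow y * r y)) ⟩
      sum (λ y → 4 * r y) + sum (λ y → 2 * (sideRow y * r y))
        ≡⟨ sym (cong₂ _+_ (*-distribˡ-sum 4 r) (*-distribˡ-sum 2 (λ y → sideRow y * r y))) ⟩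
      4 * sum r + 2 * sum (λ y → sideRow y * r y)
        ≡⟨ cong (λ t → 4 * sum r + 2 * t) (sum-sideRows r) ⟩
      4 * sum r + 2 * (r fzero + r (fromℕ ν)) ∎
      where
      expand : ∀ s x → (2 + s) * (x + x) ≡ 4 * x + 2 * (s * x)
      expand = solve-∀

    -- The vertical edges contribute 2 r y for each row neighbour of y: every
    -- row but the first and the last has two of them.
    vertical-rows : ∀ (r : Fin (suc ν) → ℕ) →
      sum (λ y → 2 * (r (inject₁ y) + r (fsuc y))) + 2 * (r fzero + r (fromℕ ν)) ≡ 4 * sum r
    vertical-rows r = begin
      sum (λ y → 2 * (r (inject₁ y) + r (fsuc y))) + 2 * (r fzero + r (fromℕ ν))
        ≡⟨ cong (_+ 2 * (r fzero + r (fromℕ ν))) (sym (*-distribˡ-sum 2 (λ y → r (inject₁ y) + r (fsuc y)))) ⟩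
      2 * sum (λ y → r (inject₁ y) + r (fsuc y)) + 2 * (r fzero + r (fromℕ ν))
        ≡⟨ cong (λ t → 2 * t + 2 * (r fzero + r (fromℕ ν))) (∑-distrib-+ (r ∘ inject₁) (r ∘ fsuc)) ⟩
      2 * (sum (r ∘ inject₁) + sum (r ∘ fsuc)) + 2 * (r fzero + r (fromℕ ν))
        ≡⟨ regroup (sum (r ∘ inject₁)) (sum (r ∘ fsuc)) (r fzero) (r (fromℕ ν)) ⟩
      2 * ((sum (r ∘ inject₁) + r (fromℕ ν)) + (r fzero + sum (r ∘ fsuc)))
        ≡⟨ cong (λ t → 2 * (t + sum r)) (sym (sum-init-last r)) ⟩
      2 * (sum r + sum r)
        ≡⟨ double (sum r) ⟩
      4 * sum r ∎
      where
      regroup : ∀ p q a z → 2 * (p + q) + 2 * (a + z) ≡ 2 * ((p + z) + (a + q))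
      regroup = solve-∀
      double : ∀ x → 2 * (x + x) ≡ 4 * x
      double = solve-∀

    rows-balance : ∀ (r : Fin (suc ν) → ℕ) →
      sum (λ y → (2 + sideRow y) * (r y + r y)) + sum (λ y → 2 * (r (inject₁ y) + r (fsuc y)))
        ≡ 8 * sum r
    rows-balance r = begin
      sum (λ y → (2 + sideRow y) * (r y + r y)) + V
        ≡⟨ cong (_+ V) (horizontal-rows r) ⟩
      4 * sum r + 2 * (r fzero + r (fromℕ ν)) + V
        ≡⟨ swap (4 * sum r) (2 * (r fzero + r (fromℕ ν))) V ⟩
      4 * sum r + (V + 2 * (r fzero + r (fromℕ ν)))
        ≡⟨ cong (4 * sum r +_) (vertical-rows r) ⟩
      4 * sum r + 4 * sum r
        ≡⟨ sym (ℕP.*-distribʳ-+ (sum r) 4 4) ⟩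
      8 * sum r ∎
      where
      V : ℕ
      V = sum (λ y → 2 * (r (inject₁ y) + r (fsuc y)))
      swap : ∀ x e v → x + e + v ≡ x + (v + e)
      swap = solve-∀

    weight : Edge ν → ℕ
    weight e = 2 + 𝟙 (isSideEdge? e)

    weight-horizontal : ∀ x y → weight ((x , y) , (next (2 * ν) x , y)) ≡ 2 + sideRow y
    weight-horizontal x y = cong (2 +_) (𝟙-×-idem ((toℕ y ℕP.≟ 0) ⊎-dec (toℕ y ℕP.≟ ν)))

    -- A vertical edge joins rows y and y + 1 < ν + 1; as ν ≥ 2 these are never
    -- both side rows.
    vertical-not-side : ∀ x (y : Fin ν) → ¬ isSideEdge {ν} ((x , inject₁ y) , (x , fsuc y))
    vertical-not-side x y (inj₁ y≡0 , inj₁ ())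
    vertical-not-side x y (inj₁ y≡0 , inj₂ y+1≡ν) =
      ℕP.0≢1+n (trans (sym y≡0) (trans (toℕ-inject₁ y) (ℕP.suc-injective y+1≡ν)))
    vertical-not-side x y (inj₂ y≡ν , _) =
      ℕP.<-irrefl (trans (sym (toℕ-inject₁ y)) y≡ν) (toℕ<n y)

    weight-vertical : ∀ x y → weight ((x , inject₁ y) , (x , fsuc y)) ≡ 2
    weight-vertical x y =
      cong (2 +_) (𝟙-no (isSideEdge? ((x , inject₁ y) , (x , fsuc y))) (vertical-not-side x y))

    module _ (f : Vertex ν → ℕ) where

      rowSum : Fin (suc ν) → ℕ
      rowSum y = sum (λ x → f (x , y))

      load : Edge ν → ℕ
      load e = weight e * (f (proj₁ e) + f (proj₂ e))

      -- The horizontal edges of row y form a cycle, so each vertex of the row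
      -- is an endpoint of two of them.
      load-horizontal : ∑ₗ load (hEdges ν) ≡ sum (λ y → (2 + sideRow y) * (rowSum y + rowSum y))
      load-horizontal = trans (∑ₗ-grid (suc ν) (2 * ν) load (λ y x → ((x , y) , (next (2 * ν) x , y))))
                              (sum-cong-≗ row)
        where
        row : ∀ y → sum (λ x → load ((x , y) , (next (2 * ν) x , y)))
                      ≡ (2 + sideRow y) * (rowSum y + rowSum y)
        row y = begin
          sum (λ x → load ((x , y) , (next (2 * ν) x , y)))
            ≡⟨ sum-cong-≗ (λ x → cong (_* (f (x , y) + f (next (2 * ν) x , y))) (weight-horizontal x y)) ⟩
          sum (λ x → (2 + sideRow y) * (f (x , y) + f (next (2 * ν) x , y)))
            ≡⟨ sym (*-distribˡ-sum (2 + sideRow y) (λ x → f (x , y) + f (next (2 * ν) x , y))) ⟩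
          (2 + sideRow y) * sum (λ x → f (x , y) + f (next (2 * ν) x , y))
            ≡⟨ cong ((2 + sideRow y) *_) (∑-distrib-+ (λ x → f (x , y)) (λ x → f (next (2 * ν) x , y))) ⟩
          (2 + sideRow y) * (rowSum y + sum (λ x → f (next (2 * ν) x , y)))
            ≡⟨ cong (λ t → (2 + sideRow y) * (rowSum y + t)) (sum-rotate _ (λ x → f (x , y))) ⟩
          (2 + sideRow y) * (rowSum y + rowSum y) ∎

      load-vertical : ∑ₗ load (vEdges ν) ≡ sum (λ y → 2 * (rowSum (inject₁ y) + rowSum (fsuc y)))
      load-vertical = trans (∑ₗ-grid ν (2 * ν) load (λ y x → ((x , inject₁ y) , (x , fsuc y))))
                            (sum-cong-≗ layer)
        where
        layer : ∀ y → sum (λ x → load ((x , inject₁ y) , (x , fsuc y)))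
                        ≡ 2 * (rowSum (inject₁ y) + rowSum (fsuc y))
        layer y = begin
          sum (λ x → load ((x , inject₁ y) , (x , fsuc y)))
            ≡⟨ sum-cong-≗ (λ x → cong (_* (f (x , inject₁ y) + f (x , fsuc y))) (weight-vertical x y)) ⟩
          sum (λ x → 2 * (f (x , inject₁ y) + f (x , fsuc y)))
            ≡⟨ sym (*-distribˡ-sum 2 (λ x → f (x , inject₁ y) + f (x , fsuc y))) ⟩
          2 * sum (λ x → f (x , inject₁ y) + f (x , fsuc y))
            ≡⟨ cong (2 *_) (∑-distrib-+ (λ x → f (x , inject₁ y)) (λ x → f (x , fsuc y))) ⟩
          2 * (rowSum (inject₁ y) + rowSum (fsuc y)) ∎

      handshake : ∑ₗ load (edges ν) ≡ 8 * ∑ₗ f (vertices ν)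
      handshake = begin
        ∑ₗ load (hEdges ν ++ vEdges ν)
          ≡⟨ ∑ₗ-++ load (hEdges ν) (vEdges ν) ⟩
        ∑ₗ load (hEdges ν) + ∑ₗ load (vEdges ν)
          ≡⟨ cong₂ _+_ load-horizontal load-vertical ⟩
        sum (λ y → (2 + sideRow y) * (rowSum y + rowSum y))
          + sum (λ y → 2 * (rowSum (inject₁ y) + rowSum (fsuc y)))
          ≡⟨ rows-balance rowSum ⟩
        8 * sum rowSum
          ≡⟨ cong (8 *_) (sym (∑ₗ-grid (suc ν) (2 * ν) f (λ y x → (x , y)))) ⟩
        8 * ∑ₗ f (vertices ν) ∎

    -- Σₑ w(e) = 8ν(ν + 1): the handshake identity for f = 1.
    total-weight : ∑ₗ weight (edges ν) ≡ 8 * (ν * suc ν)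
    total-weight = ℕP.*-cancelˡ-≡ (∑ₗ weight (edges ν)) (8 * (ν * suc ν)) 2 (begin
      2 * ∑ₗ weight (edges ν)                 ≡⟨ sym (∑ₗ-* 2 weight (edges ν)) ⟩
      ∑ₗ (λ e → 2 * weight e) (edges ν)       ≡⟨ ∑ₗ-cong (λ e → ℕP.*-comm 2 (weight e)) (edges ν) ⟩
      ∑ₗ (load (λ _ → 1)) (edges ν)           ≡⟨ handshake (λ _ → 1) ⟩
      8 * ∑ₗ (λ _ → 1) (vertices ν)           ≡⟨ cong (8 *_) vertex-count ⟩
      8 * (suc ν * (2 * ν * 1))               ≡⟨ rearrange ν ⟩
      2 * (8 * (ν * suc ν))                   ∎)
      where
      vertex-count : ∑ₗ (λ _ → 1) (vertices ν) ≡ suc ν * (2 * ν * 1)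
      vertex-count = begin
        ∑ₗ (λ _ → 1) (vertices ν)                    ≡⟨ ∑ₗ-grid (suc ν) (2 * ν) (λ _ → 1) (λ y x → (x , y)) ⟩
        sum (λ (_ : Fin (suc ν)) → sum (λ (_ : Fin (2 * ν)) → 1))
          ≡⟨ sum-cong-≗ {n = suc ν} (λ _ → sum-const (2 * ν) 1) ⟩
        sum (λ (_ : Fin (suc ν)) → 2 * ν * 1)        ≡⟨ sum-const (suc ν) (2 * ν * 1) ⟩
        suc ν * (2 * ν * 1)                           ∎
      rearrange : ∀ n → 8 * (suc n * (2 * n * 1)) ≡ 2 * (8 * (n * suc n))
      rearrange = solve-∀

    module _ (σ : Config ν) where

      both : Fin 2 → Edge ν → ℕ
      both s e = 𝟙 (bothSpin? σ s e)

      weighted-count : ∀ s → ∑ₗ (λ e → weight e * both s e) (edges ν)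
        ≡ 2 * length (filter (bothSpin? σ s) (edges ν)) + length (filter (bothSpin? σ s) (sideEdges ν))
      weighted-count s = begin
        ∑ₗ (λ e → weight e * both s e) E
          ≡⟨ ∑ₗ-cong (λ e → ℕP.*-distribʳ-+ (both s e) 2 (𝟙 (isSideEdge? e))) E ⟩
        ∑ₗ (λ e → 2 * both s e + 𝟙 (isSideEdge? e) * both s e) E
          ≡⟨ ∑ₗ-+ (λ e → 2 * both s e) (λ e → 𝟙 (isSideEdge? e) * both s e) E ⟩
        ∑ₗ (λ e → 2 * both s e) E + ∑ₗ (λ e → 𝟙 (isSideEdge? e) * both s e) E
          ≡⟨ cong₂ _+_ (∑ₗ-* 2 (both s) E) (sym (∑ₗ-filter isSideEdge? (both s) E)) ⟩
        2 * ∑ₗ (both s) E + ∑ₗ (both s) (sideEdges ν)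
          ≡⟨ sym (cong₂ (λ m n → 2 * m + n) (length-filter (bothSpin? σ s) E)
                                             (length-filter (bothSpin? σ s) (sideEdges ν))) ⟩
        2 * length (filter (bothSpin? σ s) E) + length (filter (bothSpin? σ s) (sideEdges ν)) ∎
        where
        E : List (Edge ν)
        E = edges ν

      spinOne : Vertex ν → ℕ
      spinOne v = 𝟙 (σ v ≟ᶠ one₂)

      eight-ℓ : 8 * ℓ σ ≡ ∑ₗ (load spinOne) (edges ν)
      eight-ℓ = trans (cong (8 *_) (length-filter (λ v → σ v ≟ᶠ one₂) (vertices ν)))
                      (sym (handshake spinOne))

      edge-identity : ∀ e → weight e * both one₂ e + weight e ≡ load spinOne e + weight e * both zero₂ e
      edge-identity (u , v) = begin
        w * both one₂ (u , v) + w           ≡⟨ cong (w * both one₂ (u , v) +_) (sym (ℕP.*-identityʳ w)) ⟩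
        w * both one₂ (u , v) + w * 1       ≡⟨ sym (ℕP.*-distribˡ-+ w (both one₂ (u , v)) 1) ⟩
        w * (both one₂ (u , v) + 1)         ≡⟨ cong (w *_) (spin-identity (σ u) (σ v)) ⟩
        w * (spinOne u + spinOne v + both zero₂ (u , v))
          ≡⟨ ℕP.*-distribˡ-+ w (spinOne u + spinOne v) (both zero₂ (u , v)) ⟩
        load spinOne (u , v) + w * both zero₂ (u , v) ∎
        where
        w : ℕ
        w = weight (u , v)

      counting-identity : 8 * ℓ σ + 2 * b σ + b′ σ ≡ 2 * c σ + c′ σ + 8 * (ν * suc ν)
      counting-identity = begin
        8 * ℓ σ + 2 * b σ + b′ σ
          ≡⟨ ℕP.+-assoc (8 * ℓ σ) (2 * b σ) (b′ σ) ⟩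
        8 * ℓ σ + (2 * b σ + b′ σ)
          ≡⟨ cong₂ _+_ eight-ℓ (sym (weighted-count zero₂)) ⟩
        ∑ₗ (load spinOne) E + ∑ₗ (λ e → weight e * both zero₂ e) E
          ≡⟨ sym (∑ₗ-+ (load spinOne) (λ e → weight e * both zero₂ e) E) ⟩
        ∑ₗ (λ e → load spinOne e + weight e * both zero₂ e) E
          ≡⟨ sym (∑ₗ-cong edge-identity E) ⟩
        ∑ₗ (λ e → weight e * both one₂ e + weight e) E
          ≡⟨ ∑ₗ-+ (λ e → weight e * both one₂ e) weight E ⟩
        ∑ₗ (λ e → weight e * both one₂ e) E + ∑ₗ weight E
          ≡⟨ cong₂ _+_ (weighted-count one₂) total-weight ⟩
        2 * c σ + c′ σ + 8 * (ν * suc ν) ∎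
        where
        E : List (Edge ν)
        E = edges ν

open Counting using (module Gadget)
open import Data.Nat using (ℕ; _<_; suc; s≤s)
import Data.Nat as ℕ
open import Data.Integer using (+_)
import Data.Integer as ℤ
import Data.Integer.Properties as ℤP
open import Data.Rational using (ℚ; _/_; _+_; _-_; _*_; mkℚ)
open import Data.Rational.Properties using (normalize-coprime)
open import Data.Rational.Solver using (module +-*-Solver)
open import Data.Nat.Coprimality using (1-coprimeTo) renaming (sym to coprime-sym)
open import Relation.Binary.PropositionalEquality using (_≡_; refl; cong; cong₂; sym; module ≡-Reasoning)
open ≡-Reasoning
open +-*-Solver using (solve; con; _:+_; _:*_; _:-_; _:=_)

ι : ℕ → ℚ
ι n = (+ n) / 1

ι-mkℚ : ∀ n → ι n ≡ mkℚ (+ n) 0 (coprime-sym (1-coprimeTo n))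
ι-mkℚ n = normalize-coprime (coprime-sym (1-coprimeTo n))

ι-+ : ∀ m n → ι (m ℕ.+ n) ≡ ι m + ι n
ι-+ m n = sym (begin
  ι m + ι n                            ≡⟨ cong₂ _+_ (ι-mkℚ m) (ι-mkℚ n) ⟩
  (+ m ℤ.* + 1 ℤ.+ + n ℤ.* + 1) / 1    ≡⟨ cong (_/ 1) (cong₂ ℤ._+_ (ℤP.*-identityʳ (+ m)) (ℤP.*-identityʳ (+ n))) ⟩
  ι (m ℕ.+ n)                          ∎)

ι-* : ∀ m n → ι (m ℕ.* n) ≡ ι m * ι n
ι-* m n = sym (begin
  ι m * ι n           ≡⟨ cong₂ _*_ (ι-mkℚ m) (ι-mkℚ n) ⟩
  (+ m ℤ.* + n) / 1   ≡⟨ cong (_/ 1) (sym (ℤP.pos-* m n)) ⟩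
  ι (m ℕ.* n)         ∎)

cast-identity : ∀ x y z u v w → 8 ℕ.* x ℕ.+ 2 ℕ.* y ℕ.+ z ≡ 2 ℕ.* u ℕ.+ v ℕ.+ 8 ℕ.* w →
  ι 8 * ι x + ι 2 * ι y + ι z ≡ ι 2 * ι u + ι v + ι 8 * ι w
cast-identity x y z u v w eq = begin
  ι 8 * ι x + ι 2 * ι y + ι z         ≡⟨ cong₂ (λ p q → p + q + ι z) (sym (ι-* 8 x)) (sym (ι-* 2 y)) ⟩
  ι (8 ℕ.* x) + ι (2 ℕ.* y) + ι z     ≡⟨ cong (_+ ι z) (sym (ι-+ (8 ℕ.* x) (2 ℕ.* y))) ⟩
  ι (8 ℕ.* x ℕ.+ 2 ℕ.* y) + ι z       ≡⟨ sym (ι-+ (8 ℕ.* x ℕ.+ 2 ℕ.* y) z) ⟩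
  ι (8 ℕ.* x ℕ.+ 2 ℕ.* y ℕ.+ z)       ≡⟨ cong ι eq ⟩
  ι (2 ℕ.* u ℕ.+ v ℕ.+ 8 ℕ.* w)       ≡⟨ ι-+ (2 ℕ.* u ℕ.+ v) (8 ℕ.* w) ⟩
  ι (2 ℕ.* u ℕ.+ v) + ι (8 ℕ.* w)     ≡⟨ cong (_+ ι (8 ℕ.* w)) (ι-+ (2 ℕ.* u) v) ⟩
  ι (2 ℕ.* u) + ι v + ι (8 ℕ.* w)     ≡⟨ cong₂ (λ p q → p + ι v + q) (ι-* 2 u) (ι-* 8 w) ⟩
  ι 2 * ι u + ι v + ι 8 * ι w         ∎

divide-by-8 : ∀ l b c b′ c′ n → 8 ℕ.* l ℕ.+ 2 ℕ.* b ℕ.+ b′ ≡ 2 ℕ.* c ℕ.+ c′ ℕ.+ 8 ℕ.* n →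
  ι l ≡ (+ 1 / 4) * (ι c - ι b) + (+ 1 / 8) * (ι c′ - ι b′) + ι n
divide-by-8 l b c b′ c′ n eq = sym (begin
  ¼ * (ι c - ι b) + ⅛ * (ι c′ - ι b′) + ι n
    ≡⟨ common-denominator (ι b) (ι c) (ι b′) (ι c′) (ι n) ⟩
  ⅛ * ((ι 2 * ι c + ι c′ + ι 8 * ι n) - (ι 2 * ι b + ι b′))
    ≡⟨ cong (λ t → ⅛ * (t - (ι 2 * ι b + ι b′))) (sym (cast-identity l b b′ c c′ n eq)) ⟩
  ⅛ * ((ι 8 * ι l + ι 2 * ι b + ι b′) - (ι 2 * ι b + ι b′))
    ≡⟨ cancel (ι l) (ι b) (ι b′) ⟩
  ι l ∎)
  where
  ¼ ⅛ : ℚ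
  ¼ = + 1 / 4
  ⅛ = + 1 / 8

  common-denominator : ∀ b c b′ c′ n →
    ¼ * (c - b) + ⅛ * (c′ - b′) + n ≡ ⅛ * ((ι 2 * c + c′ + ι 8 * n) - (ι 2 * b + b′))
  common-denominator = solve 5 (λ b c b′ c′ n →
    con ¼ :* (c :- b) :+ con ⅛ :* (c′ :- b′) :+ n
      := con ⅛ :* ((con (ι 2) :* c :+ c′ :+ con (ι 8) :* n) :- (con (ι 2) :* b :+ b′))) refl

  cancel : ∀ l b b′ → ⅛ * ((ι 8 * l + ι 2 * b + b′) - (ι 2 * b + b′)) ≡ l
  cancel = solve 3 (λ l b b′ →
    con ⅛ :* ((con (ι 8) :* l :+ con (ι 2) :* b :+ b′) :- (con (ι 2) :* b :+ b′)) := l) refl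

lemma8 : (ν : ℕ) → 2 < ν → (σ : Config ν) →
    (+ ℓ σ) / 1 ≡ (+ 1 / 4) * ((+ c σ) / 1 - (+ b σ) / 1)
                  + (+ 1 / 8) * ((+ c′ σ) / 1 - (+ b′ σ) / 1)
                  + (+ (ν Data.Nat.* suc ν)) / 1
lemma8 ν@(suc (suc (suc k))) (s≤s (s≤s (s≤s _))) σ =
  divide-by-8 (ℓ σ) (b σ) (c σ) (b′ σ) (c′ σ) (ν ℕ.* suc ν) (Gadget.counting-identity (suc k) σ)
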